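{- Let $r\ge3$ be an odd integer and let $a=r+1$. The subtraction game $\mathcal{S}(1,a,a+r)=\mathcal{S}(1,a,2a-1)$ is periodic with period $2a$ and nim-sequence $(01)^{a/2}\,2\,(01)^{(a-2)/2}\,2$. Moreover, the subtraction set is non-expandable.
   Context: For a finite set $S$ of positive integers, the subtraction game $\mathcal{S}(S)$ is played on a single pile: two players alternately remove $s\in S$ coins (at most the pile size); the last mover wins. The nim-value is $\mathcal{G}(n)=\operatorname{mex}\{\mathcal{G}(n-s): s\in S, s\le n\}$. Words of single digits are written by juxtaposition, and $x^m$ denotes $m$-fold repetition of the block $x$. "The game is periodic with period $p$ and nim-sequence $W$" ($W$ a word of length $p$) means $\mathcal{G}(n+p)=\mathcal{G}(n)$ for all $n\ge0$, $p$ is the least such, and $\mathcal{G}(n)$ is the $((n\bmod p)+1)$-st letter of $W$ for all $n\ge0$. The expansion of $S$ is $S^{ex}=\{s\ge1:\mathcal{G}(n+s)\ne\mathcal{G}(n)\ \forall n\ge0\}$. For a set $X$ and $p\ge1$, $X^{*p}=\{x+mp:x\in X,m\ge0\}$. $S$ is non-expandable if $S^{ex}=S$ or $S^{ex}=S^{*p}$, $p$ the period of the game. -}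

module Defs where

open import Data.Nat using (ℕ; zero; suc; _+_; _*_; _∸_; _≤_; _<_; _≤ᵇ_; _≡ᵇ_; NonZero)
open import Data.Nat.DivMod using (_%_)
open import Data.Bool using (Bool; true; false; if_then_else_; _∧_)
open import Data.List using (List; []; _∷_; length; _++_; foldr)
open import Data.Maybe using (Maybe; just; nothing)
open import Data.Product using (Σ; _×_; ∃-syntax)
open import Data.Sum using (_⊎_)
open import Relation.Binary.PropositionalEquality using (_≡_; _≢_)
open import Relation.Nullary using (¬_)
open import Data.List.Membership.Propositional using (_∈_)

elem : ℕ → List ℕ → Bool
elem k []       = false
elem k (x ∷ xs) = if k ≡ᵇ x then true else elem k xs

-- mex of a finite list: least k not occurring in L (always ≤ length L)
mexAux : List ℕ → ℕ → ℕ → ℕ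
mexAux L zero    k = k
mexAux L (suc f) k = if elem k L then mexAux L f (suc k) else k

mex : List ℕ → ℕ
mex L = mexAux L (suc (length L)) 0

_!!_ : {A : Set} → List A → ℕ → Maybe A
[]       !! _     = nothing
(x ∷ xs) !! zero  = just x
(x ∷ xs) !! suc i = xs !! i

-- Given prev = [G(n-1), G(n-2), ..., G(0)] (length n), the option values at
-- position n: G(n-s) for s ∈ S with 1 ≤ s ≤ n (G(n-s) is entry s-1 of prev).
options : List ℕ → List ℕ → List ℕ
options []       prev = []
options (s ∷ S) prev with prev !! (s ∸ 1) | 1 ≤ᵇ s
... | just v  | true  = v ∷ options S prev
... | _       | _     = options S prev

values : List ℕ → ℕ → List ℕ
values S zero    = mex (options S []) ∷ []
values S (suc n) = let prev = values S n in mex (options S prev) ∷ prev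

grundy : List ℕ → ℕ → ℕ
grundy S n with values S n
... | []    = 0
... | v ∷ _ = v

IsPeriod : (ℕ → ℕ) → ℕ → Set
IsPeriod G p = 1 ≤ p × (∀ n → G (n + p) ≡ G n)
             × (∀ q → 1 ≤ q → q < p → ¬ (∀ n → G (n + q) ≡ G n))

PeriodicWith : (ℕ → ℕ) → (p : ℕ) → .{{NonZero p}} → List ℕ → Set
PeriodicWith G p W = IsPeriod G p × length W ≡ p
                   × (∀ n → W !! (n % p) ≡ just (G n))

pow : List ℕ → ℕ → List ℕ
pow x zero    = []
pow x (suc m) = x ++ pow x m

InExpansion : List ℕ → ℕ → Set
InExpansion S s = 1 ≤ s × (∀ n → grundy S (n + s) ≢ grundy S n)

InStar : List ℕ → ℕ → ℕ → Set
InStar X p s = ∃[ x ] ∃[ m ] (x ∈ X × s ≡ x + m * p)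

SameSet : (ℕ → Set) → (ℕ → Set) → Set
SameSet P Q = ∀ s → (P s → Q s) × (Q s → P s)

NonExpandable : List ℕ → Set
NonExpandable S = ∀ p → IsPeriod (grundy S) p →
  SameSet (InExpansion S) (λ s → s ∈ S) ⊎ SameSet (InExpansion S) (InStar S p)

module Submission where

-- Plan.  (1) General facts about mex: it is characterised as the unique m missing from a
-- list while all smaller numbers occur (this uses pigeonhole to control the fuel of `mex`).
-- (2) General facts about subtraction games: G(m) = mex of the values reachable from m, G is
-- the unique solution of that recursion, and every move s ∈ S satisfies G(n + s) ≠ G(n).
-- (3) For r = 2c + 1 we write positions as j + t·a (offset j < a, block t) and define the
-- candidate whose even blocks read (01)^(c+1) and odd blocks 2 (01)^c 2.  From the third
-- block on, the moves 1, a, a + r reach offsets j-1, j, j+1 of the two previous blocks, so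
-- the mex recursion reduces to a handful of identities between block values, which only
-- depend on the parity of the block; hence the candidate is G.  (4) Periodicity, the least
-- period, the word and the expansion are then read off the candidate: a residue k < 2a with
-- G(n + k) ≠ G(n) for all n must be a move, witnessed by n = 0 or n = r.

open import Defs
open import Data.Nat using (ℕ; zero; suc; _+_; _*_; _∸_; _≤_; _<_; _≡ᵇ_; _≤?_; z≤n; s≤s; z<s; pred; >-nonZero)
open import Data.Nat.Properties
open import Data.Nat.Induction using (<-rec)
open import Data.Nat.Tactic.RingSolver using (solve-∀)
open import Data.Nat.DivMod using (_%_; _/_; [m+kn]%n≡m%n; m<n⇒m%n≡m; +-distrib-/-∣ʳ; m<n⇒m/n≡0; m*n/n≡m; m≡m%n+[m/n]*n; m%n<n; m<n*o⇒m/o<n)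
open import Data.Nat.Divisibility using (_∣_; divides; n∣m*n; ∣m∣n⇒∣m+n; ∣-refl)
open import Data.Maybe using (just; nothing; maybe′)
open import Data.Bool using (true; false; T; if_then_else_)
open import Data.Unit using (tt)
open import Data.Fin using (Fin; toℕ)
open import Data.Fin.Properties using (pigeonhole; toℕ<n)
open import Data.List using (List; []; _∷_; _++_; length; lookup)
open import Data.List.Properties using (length-++)
open import Data.List.Relation.Unary.Any using (here; there; index)
open import Data.List.Relation.Unary.Any.Properties using (lookup-index)
open import Data.List.Relation.Unary.All as All using (All; []; _∷_)
open import Data.List.Membership.Propositional using (_∈_; _∉_)
open import Data.Product using (_×_; _,_; proj₁; ∃-syntax)
open import Data.Sum using (_⊎_; inj₁; inj₂)
open import Data.Empty using (⊥-elim)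
open import Function using (_∘_)
open import Relation.Nullary using (¬_; yes; no; contradiction)
open import Relation.Binary.PropositionalEquality
open import Relation.Binary using (tri<; tri≈; tri>)

≡ᵇ-refl : ∀ n → (n ≡ᵇ n) ≡ true
≡ᵇ-refl zero    = refl
≡ᵇ-refl (suc n) = ≡ᵇ-refl n

elem-sound : ∀ {k} L → elem k L ≡ true → k ∈ L
elem-sound {k} (x ∷ L) e with k ≡ᵇ x in k≡ᵇx
... | true  = here (≡ᵇ⇒≡ k x (subst T (sym k≡ᵇx) tt))
... | false = there (elem-sound L e)

elem-complete : ∀ {k L} → k ∈ L → elem k L ≡ true
elem-complete {k} (here refl) rewrite ≡ᵇ-refl k = refl
elem-complete {k} {x ∷ L} (there k∈L) with k ≡ᵇ x
... | true  = refl
... | false = elem-complete k∈L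

-- Pigeonhole: a list containing all of 0, …, k-1 has length at least k.
-- (Send each i < k to the position of an occurrence of i; this map is injective.)
initial-segment-bound : ∀ {k} L → (∀ i → i < k → i ∈ L) → k ≤ length L
initial-segment-bound {k} L below = ≮⇒≥ λ len<k →
  let (i , j , i<j , same) = pigeonhole len<k position in
  <⇒≢ i<j (trans (occurs i) (trans (cong (lookup L) same) (sym (occurs j))))
  where
  position : Fin k → Fin (length L)
  position i = index (below (toℕ i) (toℕ<n i))
  occurs : ∀ i → toℕ i ≡ lookup L (position i)
  occurs i = lookup-index (below (toℕ i) (toℕ<n i))

IsMex : List ℕ → ℕ → Set
IsMex L m = m ∉ L × (∀ i → i < m → i ∈ L)

-- The search `mexAux` started at k (with 0, …, k-1 already found in L) finds the mex,
-- provided its fuel reaches past length L; by pigeonhole the mex lies below that.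
mexAux-correct : ∀ L fuel k → (∀ i → i < k → i ∈ L) → length L < k + fuel →
                 IsMex L (mexAux L fuel k)
mexAux-correct L zero k below short =
  ⊥-elim (<⇒≱ (subst (length L <_) (+-identityʳ k) short) (initial-segment-bound L below))
mexAux-correct L (suc fuel) k below short with elem k L in k∈?L
... | true  = mexAux-correct L fuel (suc k) below′ (subst (length L <_) (+-suc k fuel) short)
  where
  below′ : ∀ i → i < suc k → i ∈ L
  below′ i i<1+k with m<1+n⇒m<n∨m≡n i<1+k
  ... | inj₁ i<k  = below i i<k
  ... | inj₂ refl = elem-sound L k∈?L
... | false = (λ k∈L → contradiction (trans (sym (elem-complete k∈L)) k∈?L) λ ()) , below

mex-correct : ∀ L → IsMex L (mex L)
mex-correct L = mexAux-correct L (suc (length L)) 0 (λ _ ()) ≤-refl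

mex-unique : ∀ {L m} → IsMex L m → mex L ≡ m
mex-unique {L} {m} (m∉L , below) with mex-correct L | <-cmp (mex L) m
... | (mex∉L , _) | tri< mex<m _ _ = contradiction (below (mex L) mex<m) mex∉L
... | _ | tri≈ _ eq _ = eq
... | (_ , below′) | tri> _ _ m<mex = contradiction (below′ m m<mex) m∉L

Bit : ℕ → Set
Bit b = b ≡ 0 ⊎ b ≡ 1

BitOrTwo : ℕ → ℕ → Set
BitOrTwo b x = x ≡ b ⊎ x ≡ 2

mex-complement : ∀ {b L} → Bit b → All (BitOrTwo b) L → b ∈ L → mex L ≡ 1 ∸ b
mex-complement {b} {L} bit entries b∈L = mex-unique (absent bit , below bit)
  where
  absent : Bit b → 1 ∸ b ∉ L
  absent (inj₁ refl) x∈L with All.lookup entries x∈L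
  ... | inj₁ ()
  ... | inj₂ ()
  absent (inj₂ refl) x∈L with All.lookup entries x∈L
  ... | inj₁ ()
  ... | inj₂ ()
  below : Bit b → ∀ i → i < 1 ∸ b → i ∈ L
  below (inj₁ refl) zero _ = b∈L
  below (inj₁ refl) (suc _) (s≤s ())
  below (inj₂ refl) _ ()

reachable : (ℕ → ℕ) → List ℕ → ℕ → List ℕ
reachable f []          m = []
reachable f (zero ∷ S)  m = reachable f S m
reachable f (suc s ∷ S) m with suc s ≤? m
... | yes _ = f (m ∸ suc s) ∷ reachable f S m
... | no  _ = reachable f S m

values-lookup : ∀ S {n i} → i ≤ n → values S n !! i ≡ just (grundy S (n ∸ i))
values-lookup S {zero}  z≤n     = refl
values-lookup S {suc n} z≤n     = refl
values-lookup S {suc n} (s≤s i≤n) = values-lookup S i≤n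

values-beyond : ∀ S {n i} → n < i → values S n !! i ≡ nothing
values-beyond S {zero}  (s≤s _)   = refl
values-beyond S {suc n} (s≤s n<i) = values-beyond S n<i

options-step : ∀ s S prev → options (suc s ∷ S) prev ≡ maybe′ (_∷ options S prev) (options S prev) (prev !! s)
options-step s S prev with prev !! s
... | just _  = refl
... | nothing = refl

options-pass : ∀ S prev → options (zero ∷ S) prev ≡ options S prev
options-pass S prev with prev !! 0
... | just _  = refl
... | nothing = refl

options-values : ∀ T S n → options T (values S n) ≡ reachable (grundy S) T (suc n)
options-values []          S n = refl
options-values (zero ∷ T)  S n = trans (options-pass T (values S n)) (options-values T S n)
options-values (suc s ∷ T) S n with suc s ≤? suc n
... | yes (s≤s s≤n) = begin
  options (suc s ∷ T) (values S n)                   ≡⟨ options-step s T (values S n) ⟩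
  maybe′ (_∷ options T (values S n)) (options T (values S n)) (values S n !! s)
                                                     ≡⟨ cong (maybe′ _ _) (values-lookup S s≤n) ⟩
  grundy S (n ∸ s) ∷ options T (values S n)          ≡⟨ cong (grundy S (n ∸ s) ∷_) (options-values T S n) ⟩
  grundy S (n ∸ s) ∷ reachable (grundy S) T (suc n)  ∎
  where open ≡-Reasoning
... | no s≰n = begin
  options (suc s ∷ T) (values S n)                   ≡⟨ options-step s T (values S n) ⟩
  maybe′ (_∷ options T (values S n)) (options T (values S n)) (values S n !! s)
                                                     ≡⟨ cong (maybe′ _ _) (values-beyond S (≰⇒> (s≰n ∘ s≤s))) ⟩
  options T (values S n)                             ≡⟨ options-values T S n ⟩
  reachable (grundy S) T (suc n)                     ∎
  where open ≡-Reasoning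

options-empty : ∀ S → options S [] ≡ []
options-empty []      = refl
options-empty (_ ∷ S) = options-empty S

reachable-empty : ∀ f S → reachable f S 0 ≡ []
reachable-empty f []          = refl
reachable-empty f (zero ∷ S)  = reachable-empty f S
reachable-empty f (suc s ∷ S) with suc s ≤? 0
... | no _ = reachable-empty f S

grundy-mex : ∀ S m → grundy S m ≡ mex (reachable (grundy S) S m)
grundy-mex S zero    = cong mex (trans (options-empty S) (sym (reachable-empty (grundy S) S)))
grundy-mex S (suc n) = cong mex (options-values S S n)

reachable-local : ∀ {f g} S {m} → (∀ {k} → k < m → f k ≡ g k) → reachable f S m ≡ reachable g S m
reachable-local []          agree = refl
reachable-local (zero ∷ S)  agree = reachable-local S agree
reachable-local (suc s ∷ S) {m} agree with suc s ≤? m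
... | yes s<m = cong₂ _∷_ (agree (∸-monoʳ-< {m} z<s s<m)) (reachable-local S agree)
... | no  _   = reachable-local S agree

grundy-unique : ∀ S (f : ℕ → ℕ) → (∀ m → f m ≡ mex (reachable f S m)) → ∀ m → f m ≡ grundy S m
grundy-unique S f rec = <-rec (λ m → f m ≡ grundy S m) λ m below →
  trans (rec m) (trans (cong mex (reachable-local S below)) (sym (grundy-mex S m)))

reachable-member : ∀ f {S s} n → s ∈ S → 1 ≤ s → f n ∈ reachable f S (n + s)
reachable-member f {suc s ∷ S} n (here refl) _ with suc s ≤? n + suc s
... | yes _   = here (cong f (sym (m+n∸n≡m n (suc s))))
... | no  s≰m = contradiction (m≤n+m (suc s) n) s≰m
reachable-member f {zero ∷ S}  n (here refl) ()
reachable-member f {zero ∷ S}  n (there s∈S) 1≤s = reachable-member f n s∈S 1≤s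
reachable-member f {suc x ∷ S} {s} n (there s∈S) 1≤s with suc x ≤? n + s
... | yes _ = there (reachable-member f n s∈S 1≤s)
... | no  _ = reachable-member f n s∈S 1≤s

reachable-keep : ∀ f s S {m} → suc s ≤ m → reachable f (suc s ∷ S) m ≡ f (m ∸ suc s) ∷ reachable f S m
reachable-keep f s S {m} s<m with suc s ≤? m
... | yes _   = refl
... | no  s≮m = contradiction s<m s≮m

reachable-skip : ∀ f s S {m} → m < suc s → reachable f (suc s ∷ S) m ≡ reachable f S m
reachable-skip f s S {m} m≤s with suc s ≤? m
... | yes s<m = contradiction s<m (<⇒≱ m≤s)
... | no  _   = refl

move-changes-value : ∀ {S s} n → s ∈ S → 1 ≤ s → grundy S (n + s) ≢ grundy S n
move-changes-value {S} {s} n s∈S 1≤s same =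
  proj₁ (mex-correct (reachable (grundy S) S (n + s)))
    (subst (_∈ reachable (grundy S) S (n + s)) (trans (sym same) (grundy-mex S (n + s)))
      (reachable-member (grundy S) n s∈S 1≤s))

periodic-multiple : ∀ {f : ℕ → ℕ} {p} → (∀ n → f (n + p) ≡ f n) → ∀ n m → f (n + m * p) ≡ f n
periodic-multiple {f} {p} per n zero    = cong f (+-identityʳ n)
periodic-multiple {f} {p} per n (suc m) = begin
  f (n + (p + m * p))  ≡⟨ cong f (sym (+-assoc n p (m * p))) ⟩
  f (n + p + m * p)    ≡⟨ periodic-multiple per (n + p) m ⟩
  f (n + p)            ≡⟨ per n ⟩
  f n                  ∎
  where open ≡-Reasoning

least-period-unique : ∀ {f p q} → IsPeriod f p → IsPeriod f q → p ≡ q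
least-period-unique (1≤p , per-p , least-p) (1≤q , per-q , least-q) with <-cmp _ _
... | tri< p<q _ _ = contradiction per-p (least-q _ 1≤p p<q)
... | tri≈ _ p≡q _ = p≡q
... | tri> _ _ q<p = contradiction per-q (least-p _ 1≤q q<p)

-- Games with the three moves 1, u + 1 and v + 1: the values reachable from n + 1, according
-- to which long moves are legal (n = x + u and n = y + v locate their landing spots).
module ThreeMoves (u v : ℕ) where

  moves : List ℕ
  moves = 1 ∷ suc u ∷ suc v ∷ []

  private
    legal : ∀ {n x} w → n ≡ x + w → suc w ≤ suc n
    legal {x = x} w refl = s≤s (m≤n+m w x)

    landing : ∀ {n x} w → n ≡ x + w → suc n ∸ suc w ≡ x
    landing {x = x} w refl = m+n∸n≡m x w

  reach-three : ∀ f {n x y} → n ≡ x + u → n ≡ y + v →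
                reachable f moves (suc n) ≡ f n ∷ f x ∷ f y ∷ []
  reach-three f {n} {x} {y} n≡x+u n≡y+v = begin
    reachable f moves (suc n)
      ≡⟨ reachable-keep f 0 (suc u ∷ suc v ∷ []) (s≤s z≤n) ⟩
    f n ∷ reachable f (suc u ∷ suc v ∷ []) (suc n)
      ≡⟨ cong (f n ∷_) (reachable-keep f u (suc v ∷ []) (legal u n≡x+u)) ⟩
    f n ∷ f (n ∸ u) ∷ reachable f (suc v ∷ []) (suc n)
      ≡⟨ cong (λ l → f n ∷ f (n ∸ u) ∷ l) (reachable-keep f v [] (legal v n≡y+v)) ⟩
    f n ∷ f (n ∸ u) ∷ f (n ∸ v) ∷ []
      ≡⟨ cong₂ (λ p q → f n ∷ f p ∷ f q ∷ []) (landing u n≡x+u) (landing v n≡y+v) ⟩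
    f n ∷ f x ∷ f y ∷ [] ∎
    where open ≡-Reasoning

  reach-two : ∀ f {n x} → n ≡ x + u → n < v → reachable f moves (suc n) ≡ f n ∷ f x ∷ []
  reach-two f {n} {x} n≡x+u n<v = begin
    reachable f moves (suc n)
      ≡⟨ reachable-keep f 0 (suc u ∷ suc v ∷ []) (s≤s z≤n) ⟩
    f n ∷ reachable f (suc u ∷ suc v ∷ []) (suc n)
      ≡⟨ cong (f n ∷_) (reachable-keep f u (suc v ∷ []) (legal u n≡x+u)) ⟩
    f n ∷ f (n ∸ u) ∷ reachable f (suc v ∷ []) (suc n)
      ≡⟨ cong (λ l → f n ∷ f (n ∸ u) ∷ l) (reachable-skip f v [] (s≤s n<v)) ⟩
    f n ∷ f (n ∸ u) ∷ []
      ≡⟨ cong (λ p → f n ∷ f p ∷ []) (landing u n≡x+u) ⟩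
    f n ∷ f x ∷ [] ∎
    where open ≡-Reasoning

  reach-one : ∀ f {n} → n < u → n < v → reachable f moves (suc n) ≡ f n ∷ []
  reach-one f {n} n<u n<v = begin
    reachable f moves (suc n)
      ≡⟨ reachable-keep f 0 (suc u ∷ suc v ∷ []) (s≤s z≤n) ⟩
    f n ∷ reachable f (suc u ∷ suc v ∷ []) (suc n)
      ≡⟨ cong (f n ∷_) (reachable-skip f u (suc v ∷ []) (s≤s n<u)) ⟩
    f n ∷ reachable f (suc v ∷ []) (suc n)
      ≡⟨ cong (f n ∷_) (reachable-skip f v [] (s≤s n<v)) ⟩
    f n ∷ [] ∎
    where open ≡-Reasoning

parity : ℕ → ℕ
parity zero          = 0
parity (suc zero)    = 1
parity (suc (suc n)) = parity n

parity-bit : ∀ n → Bit (parity n)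
parity-bit zero          = inj₁ refl
parity-bit (suc zero)    = inj₂ refl
parity-bit (suc (suc n)) = parity-bit n

parity-suc : ∀ n → parity (suc n) ≡ 1 ∸ parity n
parity-suc zero          = refl
parity-suc (suc zero)    = refl
parity-suc (suc (suc n)) = parity-suc n

parity-double : ∀ c → parity (c + c) ≡ 0
parity-double zero    = refl
parity-double (suc c) = trans (cong (parity ∘ suc) (+-suc c c)) (parity-double c)

parity≢2 : ∀ n → parity n ≢ 2
parity≢2 n with parity-bit n
... | inj₁ p≡0 = λ p≡2 → contradiction (trans (sym p≡0) p≡2) λ ()
... | inj₂ p≡1 = λ p≡2 → contradiction (trans (sym p≡1) p≡2) λ ()

alternating : ℕ → List ℕ
alternating k = pow (0 ∷ 1 ∷ []) k

alternating-length : ∀ k → length (alternating k) ≡ k + k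
alternating-length zero    = refl
alternating-length (suc k) = cong suc (trans (cong suc (alternating-length k)) (sym (+-suc k k)))

alternating-lookup : ∀ k {i} → i < k + k → alternating k !! i ≡ just (parity i)
alternating-lookup (suc k) {zero}        _ = refl
alternating-lookup (suc k) {suc zero}    _ = refl
alternating-lookup (suc k) {suc (suc i)} (s≤s i<) =
  alternating-lookup k (≤-pred (subst (suc (suc i) ≤_) (+-suc k k) i<))

lookup-++ˡ : ∀ (xs ys : List ℕ) {i} → i < length xs → (xs ++ ys) !! i ≡ xs !! i
lookup-++ˡ (x ∷ xs) ys {zero}  _       = refl
lookup-++ˡ (x ∷ xs) ys {suc i} (s≤s i<) = lookup-++ˡ xs ys i<

lookup-++ʳ : ∀ (xs ys : List ℕ) i → (xs ++ ys) !! (length xs + i) ≡ ys !! i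
lookup-++ʳ []       ys i = refl
lookup-++ʳ (x ∷ xs) ys i = lookup-++ʳ xs ys i

-- Landing spots in blocks of length r + 1, for a position n + 1 with n in block form: the
-- move r + 1 keeps the offset and goes one block back; the move 2r + 1 goes two blocks back
-- and one offset forward, which from offset 0 (n at offset r) gives offset 1, and from the
-- last offset r = k + 1 gives offset 0 of the previous block.
back-one : ∀ r j t → j + suc t * suc r ≡ (suc j + t * suc r) + r
back-one = solve-∀

back-two : ∀ r j t → j + suc (suc t) * suc r ≡ (suc (suc j) + t * suc r) + (r + r)
back-two = solve-∀

back-two-start : ∀ r t → r + suc t * suc r ≡ (1 + t * suc r) + (r + r)
back-two-start = solve-∀

back-two-wrap : ∀ k t → k + suc t * suc (suc k) ≡ (0 + t * suc (suc k)) + (suc k + suc k)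
back-two-wrap = solve-∀

-- Moving forward in block coordinates: by one or two whole blocks, and by r (which carries
-- offset j + 1 of block t to offset j of block t + 1).
one-block-later : ∀ A j t → (0 + 1 * A) + (j + t * A) ≡ j + suc t * A
one-block-later = solve-∀

two-blocks-later : ∀ A j t → (j + t * A) + 2 * A ≡ j + suc (suc t) * A
two-blocks-later = solve-∀

wrap-forward : ∀ r j t → (r + 0 * suc r) + (suc j + t * suc r) ≡ j + suc t * suc r
wrap-forward = solve-∀

half-double : ∀ c → (c + c) / 2 ≡ c
half-double c = trans (cong (_/ 2) (trans (cong (c +_) (sym (+-identityʳ c))) (*-comm 2 c))) (m*n/n≡m c 2)

module Game (c : ℕ) (c≥1 : 1 ≤ c) where

  r a : ℕ
  r = suc (c + c)
  a = suc r

  S : List ℕ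
  S = 1 ∷ a ∷ (a + r) ∷ []

  -- S is the three-move game with long moves r + 1 and 2r + 1.
  open ThreeMoves r (r + r) using (reach-one; reach-two; reach-three)

  G : ℕ → ℕ
  G = grundy S

  -- The odd blocks read 2 (01)^c 2 (length a).
  oddBlock : ℕ → ℕ
  oddBlock zero    = 2
  oddBlock (suc j) = if suc j ≡ᵇ r then 2 else parity j

  -- The candidate value at offset j of block t: blocks of length a alternate (01)^(c+1)
  -- and the odd block.
  blockValue : ℕ → ℕ → ℕ
  blockValue j zero          = parity j
  blockValue j (suc zero)    = oddBlock j
  blockValue j (suc (suc t)) = blockValue j t

  candidate : ℕ → ℕ
  candidate m = blockValue (m % a) (m / a)

  parity-r : parity r ≡ 1
  parity-r = trans (parity-suc (c + c)) (cong (1 ∸_) (parity-double c))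

  oddBlock-last : oddBlock r ≡ 2
  oddBlock-last = cong (if_then 2 else parity (c + c)) (≡ᵇ-refl (c + c))

  oddBlock-inner : ∀ {j} → suc j < r → oddBlock (suc j) ≡ parity j
  oddBlock-inner {j} j<r with suc j ≡ᵇ r in eq
  ... | true  = contradiction (≡ᵇ⇒≡ (suc j) r (subst T (sym eq) tt)) (<⇒≢ j<r)
  ... | false = refl

  oddBlock-near : ∀ j → BitOrTwo (parity (suc j)) (oddBlock j)
  oddBlock-near zero    = inj₂ refl
  oddBlock-near (suc j) with suc j ≡ᵇ r
  ... | true  = inj₂ refl
  ... | false = inj₁ refl

  -- The entry before the final 2 of the odd block is 1 (this uses c ≥ 1).
  oddBlock-penultimate : oddBlock (c + c) ≡ 1
  oddBlock-penultimate = begin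
    oddBlock (c + c)              ≡⟨ cong oddBlock c+c≡ ⟩
    oddBlock (suc (suc (d + d)))  ≡⟨ oddBlock-inner (subst (_< r) c+c≡ (n<1+n (c + c))) ⟩
    parity (suc (d + d))          ≡⟨ parity-suc (d + d) ⟩
    1 ∸ parity (d + d)            ≡⟨ cong (1 ∸_) (parity-double d) ⟩
    1                             ∎
    where
    open ≡-Reasoning
    d : ℕ
    d = pred c
    suc-d≡c : suc d ≡ c
    suc-d≡c = suc-pred c {{>-nonZero c≥1}}
    c+c≡ : c + c ≡ suc (suc (d + d))
    c+c≡ = begin
      c + c                 ≡⟨ cong₂ _+_ (sym suc-d≡c) (sym suc-d≡c) ⟩
      suc d + suc d         ≡⟨ cong suc (+-suc d d) ⟩
      suc (suc (d + d))     ∎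

  1<r : 1 < r
  1<r = s≤s (≤-trans c≥1 (m≤m+n c c))

  -- In the first two blocks only some moves are
  -- legal; from the third block on, position j + (t+2)·a reaches offsets j-1, j and j+1 of
  -- the two previous blocks, and blockValue only depends on the parity of t.

  first-block-step : ∀ j → blockValue (suc j) 0 ≡ mex (blockValue j 0 ∷ [])
  first-block-step j =
    trans (parity-suc j) (sym (mex-complement (parity-bit j) (inj₁ refl ∷ []) (here refl)))

  second-block-start : blockValue 0 1 ≡ mex (blockValue r 0 ∷ blockValue 0 0 ∷ [])
  second-block-start = cong (λ x → mex (x ∷ 0 ∷ [])) (sym parity-r)

  second-block-step : ∀ {j} → suc j < r →
    blockValue (suc j) 1 ≡ mex (blockValue j 1 ∷ blockValue (suc j) 0 ∷ [])
  second-block-step {j} j<r = begin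
    oddBlock (suc j)    ≡⟨ oddBlock-inner j<r ⟩
    parity j            ≡⟨ parity-suc (suc j) ⟩
    1 ∸ parity (suc j)  ≡⟨ mex-complement (parity-bit (suc j)) entries (there (here refl)) ⟨
    mex (oddBlock j ∷ parity (suc j) ∷ []) ∎
    where
    open ≡-Reasoning
    entries : All (BitOrTwo (parity (suc j))) (oddBlock j ∷ parity (suc j) ∷ [])
    entries = oddBlock-near j ∷ inj₁ refl ∷ []

  block-start : ∀ t →
    blockValue 0 t ≡ mex (blockValue r (suc t) ∷ blockValue 0 (suc t) ∷ blockValue 1 t ∷ [])
  block-start zero          = cong (λ x → mex (x ∷ 2 ∷ 1 ∷ [])) (sym oddBlock-last)
  block-start (suc zero)    =
    cong₂ (λ x y → mex (x ∷ 0 ∷ y ∷ [])) (sym parity-r) (sym (oddBlock-inner 1<r))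
  block-start (suc (suc t)) = block-start t

  block-step : ∀ t {j} → suc j < r →
    blockValue (suc j) t ≡
      mex (blockValue j t ∷ blockValue (suc j) (suc t) ∷ blockValue (suc (suc j)) t ∷ [])
  block-step zero {j} j<r = begin
    parity (suc j)  ≡⟨ parity-suc j ⟩
    1 ∸ parity j    ≡⟨ mex-complement (parity-bit j) entries (here refl) ⟨
    mex (parity j ∷ oddBlock (suc j) ∷ parity j ∷ []) ∎
    where
    open ≡-Reasoning
    entries : All (BitOrTwo (parity j)) (parity j ∷ oddBlock (suc j) ∷ parity j ∷ [])
    entries = inj₁ refl ∷ inj₁ (oddBlock-inner j<r) ∷ inj₁ refl ∷ []
  block-step (suc zero) {j} j<r = begin
    oddBlock (suc j)    ≡⟨ oddBlock-inner j<r ⟩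
    parity j            ≡⟨ parity-suc (suc j) ⟩
    1 ∸ parity (suc j)  ≡⟨ mex-complement (parity-bit (suc j)) entries (there (here refl)) ⟨
    mex (oddBlock j ∷ parity (suc j) ∷ oddBlock (suc (suc j)) ∷ []) ∎
    where
    open ≡-Reasoning
    entries : All (BitOrTwo (parity (suc j))) (oddBlock j ∷ parity (suc j) ∷ oddBlock (suc (suc j)) ∷ [])
    entries = oddBlock-near j ∷ inj₁ refl ∷ oddBlock-near (suc (suc j)) ∷ []
  block-step (suc (suc t)) j<r = block-step t j<r

  block-end : ∀ t →
    blockValue r t ≡ mex (blockValue (c + c) t ∷ blockValue r (suc t) ∷ blockValue 0 (suc t) ∷ [])
  block-end zero          = trans parity-r
    (cong₂ (λ x y → mex (x ∷ y ∷ 2 ∷ [])) (sym (parity-double c)) (sym oddBlock-last))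
  block-end (suc zero)    = trans oddBlock-last
    (cong₂ (λ x y → mex (x ∷ y ∷ 0 ∷ [])) (sym oddBlock-penultimate) (sym parity-r))
  block-end (suc (suc t)) = block-end t

  candidate-block : ∀ t {j} → j < a → candidate (j + t * a) ≡ blockValue j t
  candidate-block t {j} j<a = cong₂ blockValue offset-eq block-eq
    where
    offset-eq : (j + t * a) % a ≡ j
    offset-eq = trans ([m+kn]%n≡m%n j t a) (m<n⇒m%n≡m j<a)
    block-eq : (j + t * a) / a ≡ t
    block-eq = trans (+-distrib-/-∣ʳ j (n∣m*n t)) (cong₂ _+_ (m<n⇒m/n≡0 j<a) (m*n/n≡m t a))

  data Offset : ℕ → Set where
    first : Offset 0
    inner : ∀ {j} → suc j < r → Offset (suc j)
    last  : Offset r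

  offset : ∀ {j} → j < a → Offset j
  offset {zero}  _   = first
  offset {suc j} j<a with suc j ≟ r
  ... | yes refl = last
  ... | no  j≢r  = inner (≤∧≢⇒< (≤-pred j<a) j≢r)

  offset-bound : ∀ {j} → Offset j → j < a
  offset-bound first       = s≤s z≤n
  offset-bound (inner j<r) = m≤n⇒m≤1+n j<r
  offset-bound last        = ≤-refl

  options-one : ∀ {j} → j < r → reachable candidate S (suc (j + 0 * a)) ≡ blockValue j 0 ∷ []
  options-one {j} j<r =
    trans (reach-one candidate j+0<r (≤-trans j+0<r (m≤m+n r r)))
          (cong (_∷ []) (candidate-block 0 (m≤n⇒m≤1+n j<r)))
    where
    j+0<r : j + 0 * a < r
    j+0<r = subst (_< r) (sym (+-identityʳ j)) j<r

  options-two : ∀ j t x s → j < a → x < a → j + t * a ≡ (x + s * a) + r → j + t * a < r + r →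
    reachable candidate S (suc (j + t * a)) ≡ blockValue j t ∷ blockValue x s ∷ []
  options-two j t x s j<a x<a e n<2r =
    trans (reach-two candidate e n<2r)
          (cong₂ _∷_ (candidate-block t j<a) (cong (_∷ []) (candidate-block s x<a)))

  options-three : ∀ j t x s y w → j < a → x < a → y < a →
    j + t * a ≡ (x + s * a) + r → j + t * a ≡ (y + w * a) + (r + r) →
    reachable candidate S (suc (j + t * a)) ≡ blockValue j t ∷ blockValue x s ∷ blockValue y w ∷ []
  options-three j t x s y w j<a x<a y<a e₁ e₂ =
    trans (reach-three candidate e₁ e₂)
      (cong₂ _∷_ (candidate-block t j<a)
        (cong₂ _∷_ (candidate-block s x<a) (cong (_∷ []) (candidate-block w y<a))))

  0<a : 0 < a
  0<a = s≤s z≤n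

  before-last : c + c < a
  before-last = <-trans (n<1+n (c + c)) (n<1+n r)

  before-inner : ∀ {j} → suc j < r → j < a
  before-inner {j} j<r = <-trans (n<1+n j) (offset-bound (inner j<r))

  candidate-mex-block : ∀ t {j} → Offset j → blockValue j t ≡ mex (reachable candidate S (j + t * a))
  candidate-mex-block zero first = refl
  candidate-mex-block zero (inner {j} j<r) =
    trans (first-block-step j) (cong mex (sym (options-one (<-trans (n<1+n j) j<r))))
  candidate-mex-block zero last =
    trans (first-block-step (c + c)) (cong mex (sym (options-one (n<1+n (c + c)))))
  candidate-mex-block (suc zero) first =
    trans second-block-start (cong mex (sym
      (options-two r 0 0 0 ≤-refl 0<a (+-identityʳ r) (+-monoʳ-< r (s≤s z≤n)))))
  candidate-mex-block (suc zero) (inner {j} j<r) =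
    trans (second-block-step j<r) (cong mex (sym
      (options-two j 1 (suc j) 0 (before-inner j<r) (offset-bound (inner j<r)) (back-one r j 0) n<r+r)))
    where
    n<r+r : j + 1 * a < r + r
    n<r+r = subst (_< r + r) (sym (back-one r j 0))
                  (+-monoˡ-< r (subst (_< r) (sym (+-identityʳ (suc j))) j<r))
  candidate-mex-block (suc zero) last =
    trans (block-end 1) (cong mex (sym
      (options-three (c + c) 1 r 0 0 0 before-last ≤-refl 0<a
        (back-one r (c + c) 0) (back-two-wrap (c + c) 0))))
  candidate-mex-block (suc (suc t)) first =
    trans (block-start t) (cong mex (sym
      (options-three r (suc t) 0 (suc t) 1 t ≤-refl 0<a (s≤s (s≤s z≤n))
        (+-comm r (suc t * a)) (back-two-start r t))))
  candidate-mex-block (suc (suc t)) (inner {j} j<r) =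
    trans (block-step t j<r) (cong mex (sym
      (options-three j (suc (suc t)) (suc j) (suc t) (suc (suc j)) t
        (before-inner j<r) (offset-bound (inner j<r)) (s≤s j<r)
        (back-one r j (suc t)) (back-two r j t))))
  candidate-mex-block (suc (suc t)) last =
    trans (block-end t) (cong mex (sym
      (options-three (c + c) (suc (suc t)) r (suc t) 0 (suc t) before-last ≤-refl 0<a
        (back-one r (c + c) (suc t)) (back-two-wrap (c + c) (suc t)))))

  candidate-mex : ∀ m → candidate m ≡ mex (reachable candidate S m)
  candidate-mex m =
    subst (λ n → candidate n ≡ mex (reachable candidate S n)) (sym (m≡m%n+[m/n]*n m a))
      (trans (candidate-block (m / a) (m%n<n m a)) (candidate-mex-block (m / a) (offset (m%n<n m a))))

  G-block : ∀ t {j} → j < a → G (j + t * a) ≡ blockValue j t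
  G-block t {j} j<a =
    trans (sym (grundy-unique S candidate candidate-mex (j + t * a))) (candidate-block t j<a)

  G-periodic : ∀ n → G (n + 2 * a) ≡ G n
  G-periodic n = begin
    G (n + 2 * a)                              ≡⟨ cong (λ m → G (m + 2 * a)) (m≡m%n+[m/n]*n n a) ⟩
    G ((n % a + (n / a) * a) + 2 * a)          ≡⟨ cong G (two-blocks-later a (n % a) (n / a)) ⟩
    G (n % a + suc (suc (n / a)) * a)          ≡⟨ G-block (suc (suc (n / a))) (m%n<n n a) ⟩
    blockValue (n % a) (n / a)                 ≡⟨ G-block (n / a) (m%n<n n a) ⟨
    G (n % a + (n / a) * a)                    ≡⟨ cong G (m≡m%n+[m/n]*n n a) ⟨
    G n                                        ∎
    where open ≡-Reasoning

  data InPeriod : ℕ → Set where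
    first-half  : ∀ {j} → Offset j → InPeriod (j + 0 * a)
    second-half : ∀ {j} → Offset j → InPeriod (j + 1 * a)

  in-period : ∀ {k} → k < 2 * a → InPeriod k
  in-period {k} k<2a = subst InPeriod (sym (m≡m%n+[m/n]*n k a))
                         (by-block (k / a) (m<n*o⇒m/o<n k<2a) (offset (m%n<n k a)))
    where
    by-block : ∀ t {j} → t < 2 → Offset j → InPeriod (j + t * a)
    by-block zero       _ o = first-half o
    by-block (suc zero) _ o = second-half o
    by-block (suc (suc _)) (s≤s (s≤s ())) _

  G-r : G (r + 0 * a) ≡ 1
  G-r = trans (G-block 0 (n<1+n r)) parity-r

  G-a : G (0 + 1 * a) ≡ 2
  G-a = G-block 1 0<a

  after-a : ∀ t {j} → j < a → G ((0 + 1 * a) + (j + t * a)) ≡ blockValue j (suc t)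
  after-a t {j} j<a = trans (cong G (one-block-later a j t)) (G-block (suc t) j<a)

  after-r : ∀ t {j} → j < a → G ((r + 0 * a) + (suc j + t * a)) ≡ blockValue j (suc t)
  after-r t {j} j<a = trans (cong G (wrap-forward r j t)) (G-block (suc t) j<a)

  -- No 1 ≤ q < 2a is a period: shifting position a (value 2) by q gives a value ≠ 2,
  -- except for q = r, where position 0 (value 0) is shifted to G r = 1.
  no-shorter-period : ∀ q → 1 ≤ q → q < 2 * a → ¬ (∀ n → G (n + q) ≡ G n)
  no-shorter-period q 1≤q q<2a = excluded (in-period q<2a) 1≤q
    where
    excluded : ∀ {q} → InPeriod q → 1 ≤ q → ¬ (∀ n → G (n + q) ≡ G n)
    excluded (first-half (inner {j} j<r)) _ per = parity≢2 j (begin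
      parity j                               ≡⟨ oddBlock-inner j<r ⟨
      oddBlock (suc j)                       ≡⟨ after-a 0 (offset-bound (inner j<r)) ⟨
      G ((0 + 1 * a) + (suc j + 0 * a))      ≡⟨ per (0 + 1 * a) ⟩
      G (0 + 1 * a)                          ≡⟨ G-a ⟩
      2                                      ∎)
      where open ≡-Reasoning
    excluded (first-half last) _ per = contradiction (trans (sym G-r) (per 0)) λ ()
    excluded (second-half {j} o) _ per = parity≢2 j (begin
      parity j                               ≡⟨ after-a 1 (offset-bound o) ⟨
      G ((0 + 1 * a) + (j + 1 * a))          ≡⟨ per (0 + 1 * a) ⟩
      G (0 + 1 * a)                          ≡⟨ G-a ⟩
      2                                      ∎)
      where open ≡-Reasoning

  -- An element k < 2a of the expansion is a move: every other residue has G(k) = G(0)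
  -- or G(r + k) = G(r).
  residue-is-move : ∀ {k} → InPeriod k → (∀ n → G (n + k) ≢ G n) → k ∈ S
  residue-is-move (first-half first)          changes = contradiction refl (changes 0)
  residue-is-move (first-half (inner {zero} _)) _     = here refl
  residue-is-move (first-half (inner {suc i} i<r)) changes with parity-bit i
  ... | inj₁ even = ⊥-elim (changes 0 (trans (G-block 0 (offset-bound (inner i<r))) even))
  ... | inj₂ odd  = ⊥-elim (changes (r + 0 * a)
                      (trans (after-r 0 (offset-bound (inner (<-trans (n<1+n (suc i)) i<r))))
                        (trans (oddBlock-inner (<-trans (n<1+n (suc i)) i<r)) (trans odd (sym G-r)))))
  residue-is-move (first-half last) changes =
    ⊥-elim (changes (r + 0 * a) (trans (after-r 0 before-last) (trans oddBlock-penultimate (sym G-r))))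
  residue-is-move (second-half first) _ = there (here (+-identityʳ a))
  residue-is-move (second-half last)  _ =
    there (there (here (trans (+-comm r (a + 0)) (cong (_+ r) (+-identityʳ a)))))
  residue-is-move (second-half (inner {i} i<r)) changes with parity-bit i
  ... | inj₁ even = ⊥-elim (changes 0
                      (trans (G-block 1 (offset-bound (inner i<r))) (trans (oddBlock-inner i<r) even)))
  ... | inj₂ odd  = ⊥-elim (changes (r + 0 * a)
                      (trans (after-r 1 (before-inner i<r)) (trans odd (sym G-r))))

  period : IsPeriod G (2 * a)
  period = s≤s z≤n , G-periodic , no-shorter-period

  G-mod : ∀ n → G n ≡ G (n % (2 * a))
  G-mod n = trans (cong G (m≡m%n+[m/n]*n n (2 * a)))
                  (periodic-multiple G-periodic (n % (2 * a)) (n / (2 * a)))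

  word evenWord oddWord : List ℕ
  word     = pow (0 ∷ 1 ∷ []) (a / 2) ++ (2 ∷ []) ++ pow (0 ∷ 1 ∷ []) ((a ∸ 2) / 2) ++ (2 ∷ [])
  evenWord = alternating (suc c)
  oddWord  = 2 ∷ alternating c ++ 2 ∷ []

  word-shape : word ≡ evenWord ++ oddWord
  word-shape = cong₂ (λ k l → alternating k ++ 2 ∷ alternating l ++ 2 ∷ []) a/2 (half-double c)
    where
    a/2 : a / 2 ≡ suc c
    a/2 = trans (cong (λ n → suc n / 2) (sym (+-suc c c))) (half-double (suc c))

  even-length : length evenWord ≡ a
  even-length = trans (alternating-length (suc c)) (cong suc (+-suc c c))

  odd-length : length oddWord ≡ a
  odd-length = cong suc (begin
    length (alternating c ++ 2 ∷ [])  ≡⟨ length-++ (alternating c) ⟩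
    length (alternating c) + 1        ≡⟨ cong (_+ 1) (alternating-length c) ⟩
    c + c + 1                         ≡⟨ +-comm (c + c) 1 ⟩
    suc (c + c)                       ∎)
    where open ≡-Reasoning

  word-length : length word ≡ 2 * a
  word-length = begin
    length word                          ≡⟨ cong length word-shape ⟩
    length (evenWord ++ oddWord)         ≡⟨ length-++ evenWord ⟩
    length evenWord + length oddWord     ≡⟨ cong₂ _+_ even-length odd-length ⟩
    a + a                                ≡⟨ cong (a +_) (+-identityʳ a) ⟨
    2 * a                                ∎
    where open ≡-Reasoning

  oddWord-lookup : ∀ {j} → Offset j → oddWord !! j ≡ just (oddBlock j)
  oddWord-lookup first = refl
  oddWord-lookup (inner {i} i<r) = begin
    (alternating c ++ 2 ∷ []) !! i
      ≡⟨ lookup-++ˡ (alternating c) _ (subst (i <_) (sym (alternating-length c)) i<c+c) ⟩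
    alternating c !! i
      ≡⟨ alternating-lookup c i<c+c ⟩
    just (parity i)
      ≡⟨ cong just (oddBlock-inner i<r) ⟨
    just (oddBlock (suc i)) ∎
    where
    open ≡-Reasoning
    i<c+c : i < c + c
    i<c+c = ≤-pred i<r
  oddWord-lookup last = begin
    (alternating c ++ 2 ∷ []) !! (c + c)
      ≡⟨ cong ((alternating c ++ 2 ∷ []) !!_) c+c≡ ⟩
    (alternating c ++ 2 ∷ []) !! (length (alternating c) + 0)
      ≡⟨ lookup-++ʳ (alternating c) _ 0 ⟩
    just 2
      ≡⟨ cong just oddBlock-last ⟨
    just (oddBlock r) ∎
    where
    open ≡-Reasoning
    c+c≡ : c + c ≡ length (alternating c) + 0
    c+c≡ = sym (trans (+-identityʳ _) (alternating-length c))

  word-lookup : ∀ {k} → InPeriod k → word !! k ≡ just (G k)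
  word-lookup {k} p = trans (cong (_!! k) word-shape) (halves p)
    where
    halves : ∀ {k} → InPeriod k → (evenWord ++ oddWord) !! k ≡ just (G k)
    halves (first-half {j} o) = begin
      (evenWord ++ oddWord) !! (j + 0 * a)
        ≡⟨ lookup-++ˡ evenWord oddWord (subst (j + 0 * a <_) (sym (alternating-length (suc c))) in-block) ⟩
      evenWord !! (j + 0 * a)
        ≡⟨ alternating-lookup (suc c) in-block ⟩
      just (parity (j + 0 * a))
        ≡⟨ cong (just ∘ parity) (+-identityʳ j) ⟩
      just (parity j)
        ≡⟨ cong just (G-block 0 (offset-bound o)) ⟨
      just (G (j + 0 * a)) ∎
      where
      open ≡-Reasoning
      in-block : j + 0 * a < suc c + suc c
      in-block = subst₂ _<_ (sym (+-identityʳ j)) (sym (cong suc (+-suc c c))) (offset-bound o)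
    halves (second-half {j} o) = begin
      (evenWord ++ oddWord) !! (j + 1 * a)
        ≡⟨ cong ((evenWord ++ oddWord) !!_) position ⟩
      (evenWord ++ oddWord) !! (length evenWord + j)
        ≡⟨ lookup-++ʳ evenWord oddWord j ⟩
      oddWord !! j
        ≡⟨ oddWord-lookup o ⟩
      just (oddBlock j)
        ≡⟨ cong just (G-block 1 (offset-bound o)) ⟨
      just (G (j + 1 * a)) ∎
      where
      open ≡-Reasoning
      position : j + 1 * a ≡ length evenWord + j
      position = trans (+-comm j (a + 0)) (cong (_+ j) (trans (+-identityʳ a) (sym even-length)))

  nim-sequence : PeriodicWith G (2 * a) word
  nim-sequence = period , word-length , λ n →
    trans (word-lookup (in-period (m%n<n n (2 * a)))) (cong just (sym (G-mod n)))

  -- S^ex = S^{*2a}: residues of expansion elements are moves, and shifting a move by a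
  -- multiple of the period keeps it in the expansion.
  move-positive : ∀ {x} → x ∈ S → 1 ≤ x
  move-positive (here refl)                 = s≤s z≤n
  move-positive (there (here refl))         = s≤s z≤n
  move-positive (there (there (here refl))) = s≤s z≤n

  expansion⊆star : ∀ {s} → InExpansion S s → InStar S (2 * a) s
  expansion⊆star {s} (_ , changes) =
    s % (2 * a) , s / (2 * a) ,
    residue-is-move (in-period (m%n<n s (2 * a))) residue-changes , m≡m%n+[m/n]*n s (2 * a)
    where
    residue-changes : ∀ n → G (n + s % (2 * a)) ≢ G n
    residue-changes n same = changes n (begin
      G (n + s)                                          ≡⟨ cong (λ m → G (n + m)) (m≡m%n+[m/n]*n s (2 * a)) ⟩
      G (n + (s % (2 * a) + s / (2 * a) * (2 * a)))      ≡⟨ cong G (+-assoc n _ _) ⟨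
      G (n + s % (2 * a) + s / (2 * a) * (2 * a))        ≡⟨ periodic-multiple G-periodic (n + s % (2 * a)) (s / (2 * a)) ⟩
      G (n + s % (2 * a))                                ≡⟨ same ⟩
      G n                                                ∎)
      where open ≡-Reasoning

  star⊆expansion : ∀ {s} → InStar S (2 * a) s → InExpansion S s
  star⊆expansion (x , m , x∈S , refl) =
    ≤-trans (move-positive x∈S) (m≤m+n x _) , λ n same →
      move-changes-value n x∈S (move-positive x∈S)
        (trans (sym (periodic-multiple G-periodic (n + x) m)) (trans (cong G (+-assoc n x _)) same))

  non-expandable : NonExpandable S
  non-expandable p p-period =
    inj₂ (subst (λ q → SameSet (InExpansion S) (InStar S q)) (least-period-unique period p-period)
                (λ s → expansion⊆star , star⊆expansion))

odd-form : ∀ r → ¬ (2 ∣ r) → ∃[ c ] r ≡ suc (c + c)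
odd-form zero          r-odd = contradiction (divides 0 refl) r-odd
odd-form (suc zero)    _     = 0 , refl
odd-form (suc (suc r)) r-odd with odd-form r (r-odd ∘ ∣m∣n⇒∣m+n ∣-refl)
... | c , refl = suc c , cong (suc ∘ suc) (sym (+-suc c c))

theorem3p5 : (r : ℕ) → 3 ≤ r → ¬ (2 ∣ r) →
    let a = suc r in
    PeriodicWith (grundy (1 ∷ a ∷ (a + r) ∷ []))
      (2 * a)
      (pow (0 ∷ 1 ∷ []) (a / 2) ++ (2 ∷ []) ++ pow (0 ∷ 1 ∷ []) ((a ∸ 2) / 2) ++ (2 ∷ []))
    × NonExpandable (1 ∷ a ∷ (a + r) ∷ [])
theorem3p5 r 3≤r r-odd with odd-form r r-odd
... | zero  , refl = contradiction 3≤r λ { (s≤s ()) }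
... | suc c , refl = nim-sequence , non-expandable
  where open Game (suc c) (s≤s z≤n)
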